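{- Let $x\in\mathrm{Cay}_n$. (1) If $y\in\mathrm{Cay}_k$ and $y\le x$, then $\gamma(y)\le\gamma(x)$. (2) If $\sigma\in S_k$ and $\sigma\le\gamma(x)$, then there exists $y\in\mathrm{Cay}_k$ such that $y\le x$ and $\gamma(y)=\sigma$.
   Context: A Cayley permutation of length $n$ is a word $x=x(1)\cdots x(n)$ of positive integers in which every integer from $1$ to $\max(x)$ occurs; $\mathrm{Cay}_n$ is the set of these, $S_k\subseteq\mathrm{Cay}_k$ the permutations of $[k]$, $\mathrm{id}_n=12\cdots n$. $y\le x$ means some subsequence $x(i_1)\cdots x(i_k)$, $i_1<\cdots<i_k$, is order isomorphic to $y$ (same relative order and same equalities among entries). For a weakly increasing Cayley permutation $u$ and a Cayley permutation $v$ of the same length, the Burge transpose $(u,v)^T$ of the biword with columns $\binom{u(i)}{v(i)}$ is obtained by turning every column upside down and then sorting the columns in increasing order of top entry, ties broken by decreasing bottom entry. For $x\in\mathrm{Cay}_n$, $\gamma(x)\in S_n$ is the bottom row of $(\mathrm{id}_n,x)^T$. -}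

module Defs where

open import Data.Nat using (ℕ; zero; suc; _≤_; _<_; _⊔_; _<ᵇ_; _≡ᵇ_)
open import Data.Bool using (Bool; true; false; if_then_else_; _∧_; _∨_)
open import Data.Fin using (Fin) renaming (_<_ to _<ꟳ_)
open import Data.List using (List; []; _∷_; length; lookup; map; zip; upTo; foldr)
open import Data.Product using (_×_; _,_; proj₁; proj₂; ∃; swap)
open import Relation.Binary.PropositionalEquality using (_≡_)
open import Function.Bundles using (_⇔_)

-- Words are lists of naturals; x(i) is  lookup x i  (0-based positions).

maxL : List ℕ → ℕ
maxL = foldr _⊔_ 0

IsCayley : List ℕ → Set
IsCayley x =
  (∀ i → 1 ≤ lookup x i) ×
  (∀ j → 1 ≤ j → j ≤ maxL x → ∃ λ i → lookup x i ≡ j)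

Cay : ℕ → List ℕ → Set
Cay n x = length x ≡ n × IsCayley x

Perm : ℕ → List ℕ → Set
Perm k σ =
  length σ ≡ k ×
  (∀ i → 1 ≤ lookup σ i × lookup σ i ≤ k) ×
  (∀ i j → lookup σ i ≡ lookup σ j → i ≡ j)

_≼_ : List ℕ → List ℕ → Set
y ≼ x = ∃ λ (f : Fin (length y) → Fin (length x)) →
  (∀ a b → a <ꟳ b → f a <ꟳ f b) ×
  (∀ a b → (lookup y a < lookup y b ⇔ lookup x (f a) < lookup x (f b)) ×
           (lookup y a ≡ lookup y b ⇔ lookup x (f a) ≡ lookup x (f b)))

-- Biwords: lists of columns (top , bottom)
Biword : Set
Biword = List (ℕ × ℕ)

colLt : ℕ × ℕ → ℕ × ℕ → Bool
colLt (a , b) (c , d) = (a <ᵇ c) ∨ ((a ≡ᵇ c) ∧ (d <ᵇ b))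

insertCol : ℕ × ℕ → Biword → Biword
insertCol c [] = c ∷ []
insertCol c (d ∷ ds) = if colLt d c then d ∷ insertCol c ds else c ∷ d ∷ ds

sortCols : Biword → Biword
sortCols = foldr insertCol []

burgeT : Biword → Biword
burgeT w = sortCols (map swap w)

idW : ℕ → List ℕ
idW n = map suc (upTo n)

γ : List ℕ → List ℕ
γ x = map proj₂ (burgeT (zip (idW (length x)) x))

-- The columns of x are the pairs (x(i), i+1), ordered by value and then by
-- decreasing position, and γ(x) lists the positions of x in increasing column
-- order. An occurrence of y in x preserves and reflects the column order, so
-- transported along the bijections between positions of a word and entries of
-- its γ it becomes an occurrence of γ(y) in γ(x). Conversely, an occurrence of σ
-- in γ(x) selects k positions of x; let y be the standardisation of the subword
-- of x there. The columns of y, listed in σ-order, correspond to columns of x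
-- that γ(x) lists in increasing order, so they increase as well. A strictly
-- sorted list is determined by its elements, so this is the sorted column list
-- of y, and γ(y) = σ.
module Submission where

open import Defs
open import Data.Bool using (true; false; T)
open import Data.Bool.Properties using (T-∨; T-∧)
open import Data.Empty using (⊥-elim)
import Data.Fin as Fin
open Fin using (Fin; toℕ; cast; fromℕ<; punchOut) renaming (_<_ to _<ꟳ_)
import Data.Fin.Properties as Finₚ
open import Data.List using (List; []; _∷_; length; lookup; map; zip; tabulate; applyUpTo; deduplicate)
open import Data.List.Properties
  using (length-map; length-tabulate; lookup-tabulate; map-tabulate; tabulate-cong; tabulate-lookup; foldr-preservesᵇ)
open import Data.List.Membership.Propositional using (_∈_)
open import Data.List.Membership.Propositional.Properties
  using (∈-lookup; ∈-tabulate⁺; ∈-tabulate⁻; ∈-deduplicate⁺; ∈-deduplicate⁻)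
open import Data.List.Relation.Unary.Any using (here; there; index)
open import Data.List.Relation.Unary.Any.Properties using (lookup-index)
open import Data.List.Relation.Unary.All as All using (All; []; _∷_)
open import Data.List.Relation.Unary.AllPairs using (AllPairs; []; _∷_)
import Data.List.Relation.Unary.AllPairs.Properties as AllPairs
import Data.List.Relation.Unary.All.Properties as All
open import Data.List.Relation.Unary.Unique.Propositional using (Unique)
open import Data.List.Relation.Binary.Permutation.Propositional
  using (_↭_; prep; swap; ↭-refl; ↭-reflexive; ↭-sym; ↭-trans)
open import Data.List.Relation.Binary.Permutation.Propositional.Properties using (All-resp-↭; ∈-resp-↭)
open import Data.Nat using (ℕ; zero; suc; _<_; _≤_; _<?_; z≤n; s≤s; s≤s⁻¹)
open import Data.Nat.Properties
  using (<-cmp; <-irrefl; <-trans; <-asym; <-≤-trans; ⊔-lub; ≤-trans; m≤n⇒m≤1+n; m<n⇒m<1+n; <⇒≤; <⇒≢; suc-injective;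
         _≟_; <ᵇ⇒<; <⇒<ᵇ; ≡ᵇ⇒≡; ≡⇒≡ᵇ; 1+n≰n)
open import Data.List.Relation.Unary.Unique.DecPropositional.Properties _≟_ using (deduplicate-!)
open import Data.Product using (_×_; _,_; proj₁; proj₂; ∃)
import Data.Product as Product
open import Data.Product.Function.NonDependent.Propositional using (_×-⇔_)
open import Data.Sum using (_⊎_; inj₁; inj₂)
open import Data.Sum.Function.Propositional using (_⊎-⇔_)
open import Data.Unit using (tt)
open import Function using (_∘_)
open import Function.Bundles using (_⇔_; mk⇔; Equivalence)
open import Function.Definitions using (Injective)
open import Relation.Binary.Core using (Rel)
open import Relation.Binary.Definitions using (Irreflexive; Transitive; tri<; tri≈; tri>)
open import Relation.Binary.PropositionalEquality
open import Relation.Nullary using (¬_; yes; no; contradiction)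

open Equivalence using (to; from)

lookup-map : ∀ {A B : Set} (f : A → B) (xs : List A) (i : Fin (length (map f xs))) →
             lookup (map f xs) i ≡ f (lookup xs (cast (length-map f xs) i))
lookup-map f (x ∷ xs) Fin.zero    = refl
lookup-map f (x ∷ xs) (Fin.suc i) = lookup-map f xs i

lookup-tabulate′ : ∀ {A : Set} {n} (f : Fin n → A) (i : Fin (length (tabulate f))) →
                   lookup (tabulate f) i ≡ f (cast (length-tabulate f) i)
lookup-tabulate′ {n = suc n} f Fin.zero    = refl
lookup-tabulate′ {n = suc n} f (Fin.suc i) = lookup-tabulate′ (f ∘ Fin.suc) i

AllPairs-lookup : ∀ {A : Set} {ℓ} {R : Rel A ℓ} {xs} → AllPairs R xs →
                  ∀ {i j} → i <ꟳ j → R (lookup xs i) (lookup xs j)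
AllPairs-lookup (x<xs ∷ _)  {Fin.zero}  {Fin.suc j} _          = All.lookup x<xs (∈-lookup j)
AllPairs-lookup (_ ∷ xs↗) {Fin.suc i} {Fin.suc j} (s≤s i<j) = AllPairs-lookup xs↗ i<j

Unique-lookup-injective : ∀ {A : Set} {xs : List A} → Unique xs →
                          ∀ {i j} → lookup xs i ≡ lookup xs j → i ≡ j
Unique-lookup-injective (_ ∷ _)    {Fin.zero}  {Fin.zero}  _ = refl
Unique-lookup-injective (x≢xs ∷ _) {Fin.zero}  {Fin.suc j} e = ⊥-elim (All.lookup x≢xs (∈-lookup j) e)
Unique-lookup-injective (x≢xs ∷ _) {Fin.suc i} {Fin.zero}  e = ⊥-elim (All.lookup x≢xs (∈-lookup i) (sym e))
Unique-lookup-injective (_ ∷ xs!)  {Fin.suc i} {Fin.suc j} e = cong Fin.suc (Unique-lookup-injective xs! e)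

∈-tabulate-reindex : ∀ {A : Set} {m n} (f : Fin n → A) (π : Fin m → Fin n) →
                     (∀ i → ∃ λ c → π c ≡ i) → ∀ {z} → z ∈ tabulate (f ∘ π) ⇔ z ∈ tabulate f
∈-tabulate-reindex f π π-onto = mk⇔ forth back
  where
  forth : ∀ {z} → z ∈ tabulate (f ∘ π) → z ∈ tabulate f
  forth z∈ with c , refl ← ∈-tabulate⁻ z∈ = ∈-tabulate⁺ (π c)
  back : ∀ {z} → z ∈ tabulate f → z ∈ tabulate (f ∘ π)
  back z∈ with i , refl ← ∈-tabulate⁻ z∈ with c , refl ← π-onto i = ∈-tabulate⁺ c

injective⇒surjective : ∀ {n} (f : Fin n → Fin n) → Injective _≡_ _≡_ f → ∀ j → ∃ λ i → f i ≡ j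
injective⇒surjective {suc n} f f-injective j with Finₚ.any? (λ i → f i Finₚ.≟ j)
... | yes hit  = hit
... | no  miss = contradiction (Finₚ.injective⇒≤ f-avoiding-j-injective) 1+n≰n
  where
  j≢f : ∀ i → j ≢ f i
  j≢f i j≡fi = miss (i , sym j≡fi)
  f-avoiding-j : Fin (suc n) → Fin n
  f-avoiding-j i = punchOut (j≢f i)
  f-avoiding-j-injective : Injective _≡_ _≡_ f-avoiding-j
  f-avoiding-j-injective {a} {b} = f-injective ∘ Finₚ.punchOut-injective (j≢f a) (j≢f b)

module StrictOrder {A : Set} {ℓ} {R : Rel A ℓ} (R-irrefl : Irreflexive _≡_ R) (R-trans : Transitive R) where

  strictlyMonotone-reflects : ∀ {n} (g : Fin n → A) → (∀ {i j} → i <ꟳ j → R (g i) (g j)) →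
                              ∀ {i j} → R (g i) (g j) → i <ꟳ j
  strictlyMonotone-reflects g g↑ {i} {j} gi<gj with Finₚ.<-cmp i j
  ... | tri< i<j _ _ = i<j
  ... | tri≈ _ refl _ = ⊥-elim (R-irrefl refl gi<gj)
  ... | tri> _ _ j<i = ⊥-elim (R-irrefl refl (R-trans gi<gj (g↑ j<i)))

  strictlyMonotone-injective : ∀ {n} (g : Fin n → A) → (∀ {i j} → i <ꟳ j → R (g i) (g j)) →
                               Injective _≡_ _≡_ g
  strictlyMonotone-injective g g↑ {i} {j} gi≡gj with Finₚ.<-cmp i j
  ... | tri< i<j _ _ = ⊥-elim (R-irrefl gi≡gj (g↑ i<j))
  ... | tri≈ _ i≡j _ = i≡j
  ... | tri> _ _ j<i = ⊥-elim (R-irrefl (sym gi≡gj) (g↑ j<i))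

  private
    ∈-tail : ∀ {a xs ys z} → All (R a) xs → z ∈ xs → z ∈ a ∷ ys → z ∈ ys
    ∈-tail a<xs z∈xs (here refl)  = ⊥-elim (R-irrefl refl (All.lookup a<xs z∈xs))
    ∈-tail _    _    (there z∈ys) = z∈ys

    heads-equal : ∀ {a b xs ys} → All (R a) xs → All (R b) ys → a ∈ b ∷ ys → b ∈ a ∷ xs → a ≡ b
    heads-equal _    _    (here a≡b)   _            = a≡b
    heads-equal _    _    (there _)    (here b≡a)   = sym b≡a
    heads-equal a<xs b<ys (there a∈ys) (there b∈xs) =
      ⊥-elim (R-irrefl refl (R-trans (All.lookup b<ys a∈ys) (All.lookup a<xs b∈xs)))

  sorted-unique : ∀ {xs ys} → AllPairs R xs → AllPairs R ys →
                  (∀ {z} → z ∈ xs → z ∈ ys) → (∀ {z} → z ∈ ys → z ∈ xs) → xs ≡ ys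
  sorted-unique []            []            _     _     = refl
  sorted-unique []            (_ ∷ _)       _     ys⊆xs with () ← ys⊆xs (here refl)
  sorted-unique (_ ∷ _)       []            xs⊆ys _     with () ← xs⊆ys (here refl)
  sorted-unique (a<xs ∷ xs↗) (b<ys ∷ ys↗) xs⊆ys ys⊆xs
    with refl ← heads-equal a<xs b<ys (xs⊆ys (here refl)) (ys⊆xs (here refl)) =
    cong (_ ∷_) (sorted-unique xs↗ ys↗ (λ z∈xs → ∈-tail a<xs z∈xs (xs⊆ys (there z∈xs)))
                                        (λ z∈ys → ∈-tail b<ys z∈ys (ys⊆xs (there z∈ys))))

StrictlyIncreasing : ∀ {m n} → (Fin m → Fin n) → Set
StrictlyIncreasing f = ∀ a b → a <ꟳ b → f a <ꟳ f b

SameOrderType : ∀ {m} → (Fin m → ℕ) → (Fin m → ℕ) → Set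
SameOrderType u v = ∀ a b → (u a < u b ⇔ v a < v b) × (u a ≡ u b ⇔ v a ≡ v b)

-- y ≼ x unfolds to ∃ (PatternEmbedding (lookup y) (lookup x)).
PatternEmbedding : ∀ {m n} → (Fin m → ℕ) → (Fin n → ℕ) → (Fin m → Fin n) → Set
PatternEmbedding u v f = StrictlyIncreasing f × SameOrderType u (v ∘ f)

module _ {m n} {f : Fin m → Fin n} (f↑ : StrictlyIncreasing f) where
  open StrictOrder (Finₚ.<-irrefl {n = n}) (Finₚ.<-trans {n = n})

  strictlyIncreasing-reflects : ∀ {a b} → f a <ꟳ f b → a <ꟳ b
  strictlyIncreasing-reflects = strictlyMonotone-reflects f (f↑ _ _)

  positions-sameOrderType : SameOrderType (suc ∘ toℕ) (suc ∘ toℕ ∘ f)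
  positions-sameOrderType a b =
    mk⇔ (s≤s ∘ f↑ a b ∘ s≤s⁻¹) (s≤s ∘ strictlyIncreasing-reflects ∘ s≤s⁻¹) ,
    mk⇔ (cong (suc ∘ toℕ ∘ f) ∘ Finₚ.toℕ-injective ∘ suc-injective)
        (cong (suc ∘ toℕ) ∘ strictlyMonotone-injective f (f↑ _ _) ∘ Finₚ.toℕ-injective ∘ suc-injective)

tabulate-≼ : ∀ {m} {w : Fin m → ℕ} {x : List ℕ} {F : Fin m → Fin (length x)} →
             PatternEmbedding w (lookup x) F → tabulate w ≼ x
tabulate-≼ {w = w} {x} {F} (F↑ , w≅xF) = F ∘ reindex , F∘reindex↑ , sameOrder
  where
  reindex : Fin (length (tabulate w)) → Fin _
  reindex = cast (length-tabulate w)
  F∘reindex↑ : StrictlyIncreasing (F ∘ reindex)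
  F∘reindex↑ a b a<b =
    F↑ _ _ (subst₂ _<_ (sym (Finₚ.toℕ-cast _ a)) (sym (Finₚ.toℕ-cast _ b)) a<b)
  sameOrder : SameOrderType (lookup (tabulate w)) (lookup x ∘ F ∘ reindex)
  sameOrder a b rewrite lookup-tabulate′ w a | lookup-tabulate′ w b = w≅xF (reindex a) (reindex b)

tabulate-isCayley : ∀ {m} (w : Fin m → ℕ) (B : ℕ) → (∀ a → 1 ≤ w a) → (∀ a → w a ≤ B) →
                    (∀ j → 1 ≤ j → j ≤ B → ∃ λ a → w a ≡ j) → IsCayley (tabulate w)
tabulate-isCayley w B positive bounded onto = entries-positive , entries-onto
  where
  entries-positive : ∀ i → 1 ≤ lookup (tabulate w) i
  entries-positive i = subst (1 ≤_) (sym (lookup-tabulate′ w i)) (positive _)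
  max≤B : maxL (tabulate w) ≤ B
  max≤B = foldr-preservesᵇ {P = _≤ B} ⊔-lub z≤n (All.tabulate⁺ bounded)
  entries-onto : ∀ j → 1 ≤ j → j ≤ maxL (tabulate w) → ∃ λ i → lookup (tabulate w) i ≡ j
  entries-onto j 1≤j j≤max with a , wa≡j ← onto j 1≤j (≤-trans j≤max max≤B) =
    cast (sym (length-tabulate w)) a , trans (lookup-tabulate w a) wa≡j

-- Dense ranks and standardisation

countBelow : ℕ → List ℕ → ℕ
countBelow u []       = 0
countBelow u (d ∷ ds) with d <? u
... | yes _ = suc (countBelow u ds)
... | no  _ = countBelow u ds

countBelow≤length : ∀ u ds → countBelow u ds ≤ length ds
countBelow≤length u []       = z≤n
countBelow≤length u (d ∷ ds) with d <? u
... | yes _ = s≤s (countBelow≤length u ds)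
... | no  _ = m≤n⇒m≤1+n (countBelow≤length u ds)

countBelow<length : ∀ {u ds} → u ∈ ds → countBelow u ds < length ds
countBelow<length {u} {d ∷ ds} u∈ with d <? u
countBelow<length {u} {d ∷ ds} (here refl)  | yes u<u = contradiction u<u (<-irrefl refl)
countBelow<length {u} {d ∷ ds} (there u∈ds) | yes _   = s≤s (countBelow<length u∈ds)
countBelow<length {u} {d ∷ ds} _            | no  _   = s≤s (countBelow≤length u ds)

countBelow-mono : ∀ {u v} ds → u ≤ v → countBelow u ds ≤ countBelow v ds
countBelow-mono []       _   = z≤n
countBelow-mono {u} {v} (d ∷ ds) u≤v with d <? u | d <? v
... | yes _   | yes _   = s≤s (countBelow-mono ds u≤v)
... | yes d<u | no  d≮v = contradiction (<-≤-trans d<u u≤v) d≮v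
... | no  _   | yes _   = m≤n⇒m≤1+n (countBelow-mono ds u≤v)
... | no  _   | no  _   = countBelow-mono ds u≤v

countBelow-strict : ∀ {u v ds} → u ∈ ds → u < v → countBelow u ds < countBelow v ds
countBelow-strict {u} {v} {d ∷ ds} (here refl) u<v with d <? d | d <? v
... | yes d<d | _       = contradiction d<d (<-irrefl refl)
... | no  _   | yes _   = s≤s (countBelow-mono ds (<⇒≤ u<v))
... | no  _   | no  d≮v = contradiction u<v d≮v
countBelow-strict {u} {v} {d ∷ ds} (there u∈ds) u<v with d <? u | d <? v | countBelow-strict u∈ds u<v
... | yes _   | yes _   | cu<cv = s≤s cu<cv
... | yes d<u | no  d≮v | _     = contradiction (<-trans d<u u<v) d≮v
... | no  _   | yes _   | cu<cv = m<n⇒m<1+n cu<cv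
... | no  _   | no  _   | cu<cv = cu<cv

countBelow-reflects : ∀ {u v ds} → v ∈ ds → countBelow u ds < countBelow v ds → u < v
countBelow-reflects {u} {v} v∈ cu<cv with <-cmp u v
... | tri< u<v _ _  = u<v
... | tri≈ _ refl _ = contradiction cu<cv (<-irrefl refl)
... | tri> _ _ v<u  = contradiction (countBelow-strict v∈ v<u) (<-asym cu<cv)

countBelow-injective : ∀ {u v ds} → u ∈ ds → v ∈ ds → countBelow u ds ≡ countBelow v ds → u ≡ v
countBelow-injective {u} {v} u∈ v∈ cu≡cv with <-cmp u v
... | tri< u<v _ _ = contradiction cu≡cv (<⇒≢ (countBelow-strict u∈ u<v))
... | tri≈ _ u≡v _ = u≡v
... | tri> _ _ v<u = contradiction (sym cu≡cv) (<⇒≢ (countBelow-strict v∈ v<u))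

-- Distinct entries get distinct ranks below length ds, so by pigeonhole every rank occurs.
countBelow-onto : ∀ {ds} → Unique ds → ∀ {j} → j < length ds → ∃ λ u → u ∈ ds × countBelow u ds ≡ j
countBelow-onto {ds} ds! {j} j<len = witness (injective⇒surjective rank rank-injective (fromℕ< j<len))
  where
  rank : Fin (length ds) → Fin (length ds)
  rank i = fromℕ< (countBelow<length (∈-lookup {xs = ds} i))
  toℕ-rank : ∀ i → toℕ (rank i) ≡ countBelow (lookup ds i) ds
  toℕ-rank i = Finₚ.toℕ-fromℕ< _
  rank-injective : Injective _≡_ _≡_ rank
  rank-injective {i} {i′} ri≡ri′ = Unique-lookup-injective ds!
    (countBelow-injective (∈-lookup {xs = ds} i) (∈-lookup i′)
      (trans (sym (toℕ-rank i)) (trans (cong toℕ ri≡ri′) (toℕ-rank i′))))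
  witness : (∃ λ i → rank i ≡ fromℕ< j<len) → ∃ λ u → u ∈ ds × countBelow u ds ≡ j
  witness (i , ri≡j) =
    lookup ds i , ∈-lookup i , trans (sym (toℕ-rank i)) (trans (cong toℕ ri≡j) (Finₚ.toℕ-fromℕ< j<len))

standardisation : ∀ {m} (v : Fin m → ℕ) → ∃ λ (w : Fin m → ℕ) → IsCayley (tabulate w) × SameOrderType w v
standardisation v = w , tabulate-isCayley w (length ds) (λ _ → s≤s z≤n) w≤length w-onto , w≅v
  where
  ds : List ℕ
  ds = deduplicate _≟_ (tabulate v)
  v∈ds : ∀ a → v a ∈ ds
  v∈ds a = ∈-deduplicate⁺ _≟_ (∈-tabulate⁺ a)
  w : Fin _ → ℕ
  w a = suc (countBelow (v a) ds)
  w≤length : ∀ a → w a ≤ length ds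
  w≤length a = countBelow<length (v∈ds a)
  w-onto : ∀ j → 1 ≤ j → j ≤ length ds → ∃ λ a → w a ≡ j
  w-onto (suc j) _ j<len
    with u , u∈ds , cu≡j ← countBelow-onto (deduplicate-! (tabulate v)) j<len
    with a , refl ← ∈-tabulate⁻ (∈-deduplicate⁻ _≟_ (tabulate v) u∈ds) = a , cong suc cu≡j
  w≅v : SameOrderType w v
  w≅v a b = mk⇔ (countBelow-reflects (v∈ds b) ∘ s≤s⁻¹) (s≤s ∘ countBelow-strict (v∈ds a)) ,
            mk⇔ (countBelow-injective (v∈ds a) (v∈ds b) ∘ suc-injective) (cong (λ u → suc (countBelow u ds)))

-- The column order and insertion sort

infix 4 _<ᶜ_
_<ᶜ_ : ℕ × ℕ → ℕ × ℕ → Set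
p <ᶜ q = proj₁ p < proj₁ q ⊎ (proj₁ p ≡ proj₁ q × proj₂ q < proj₂ p)

colLt⇒<ᶜ : ∀ p q → T (colLt p q) → p <ᶜ q
colLt⇒<ᶜ (a , b) (c , d) t with to T-∨ t
... | inj₁ a<ᵇc   = inj₁ (<ᵇ⇒< a c a<ᵇc)
... | inj₂ a≡c∧d<b = let a≡ᵇc , d<ᵇb = to T-∧ a≡c∧d<b in inj₂ (≡ᵇ⇒≡ a c a≡ᵇc , <ᵇ⇒< d b d<ᵇb)

<ᶜ⇒colLt : ∀ p q → p <ᶜ q → T (colLt p q)
<ᶜ⇒colLt (a , b) (c , d) (inj₁ a<c)         = from T-∨ (inj₁ (<⇒<ᵇ a<c))
<ᶜ⇒colLt (a , b) (c , d) (inj₂ (a≡c , d<b)) = from T-∨ (inj₂ (from T-∧ (≡⇒≡ᵇ a c a≡c , <⇒<ᵇ d<b)))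

<ᶜ-irrefl : Irreflexive _≡_ _<ᶜ_
<ᶜ-irrefl refl (inj₁ a<a)       = <-irrefl refl a<a
<ᶜ-irrefl refl (inj₂ (_ , b<b)) = <-irrefl refl b<b

<ᶜ-trans : Transitive _<ᶜ_
<ᶜ-trans (inj₁ p<q)         (inj₁ q<r)         = inj₁ (<-trans p<q q<r)
<ᶜ-trans (inj₁ p<q)         (inj₂ (q≡r , _))   = inj₁ (subst (_ <_) q≡r p<q)
<ᶜ-trans (inj₂ (p≡q , _))   (inj₁ q<r)         = inj₁ (subst (_< _) (sym p≡q) q<r)
<ᶜ-trans (inj₂ (p≡q , q<p)) (inj₂ (q≡r , r<q)) = inj₂ (trans p≡q q≡r , <-trans r<q q<p)

≯ᶜ⇒<ᶜ : ∀ p q → proj₂ p ≢ proj₂ q → ¬ q <ᶜ p → p <ᶜ q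
≯ᶜ⇒<ᶜ p q p₂≢q₂ q≮p with <-cmp (proj₁ p) (proj₁ q)
... | tri< p₁<q₁ _ _ = inj₁ p₁<q₁
... | tri> _ _ q₁<p₁ = contradiction (inj₁ q₁<p₁) q≮p
... | tri≈ _ p₁≡q₁ _ with <-cmp (proj₂ p) (proj₂ q)
...   | tri< p₂<q₂ _ _ = contradiction (inj₂ (sym p₁≡q₁ , p₂<q₂)) q≮p
...   | tri≈ _ p₂≡q₂ _ = contradiction p₂≡q₂ p₂≢q₂
...   | tri> _ _ q₂<p₂ = inj₂ (p₁≡q₁ , q₂<p₂)

<ᶜ-resp-⇔ : ∀ {a b c d a′ b′ c′ d′} →
            (a < c ⇔ a′ < c′) → (a ≡ c ⇔ a′ ≡ c′) → (d < b ⇔ d′ < b′) →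
            (a , b) <ᶜ (c , d) ⇔ (a′ , b′) <ᶜ (c′ , d′)
<ᶜ-resp-⇔ first-< first-≡ second-> = first-< ⊎-⇔ (first-≡ ×-⇔ second->)

DistinctBottoms : ℕ × ℕ → ℕ × ℕ → Set
DistinctBottoms p q = proj₂ p ≢ proj₂ q

insertCol-↭ : ∀ c ds → insertCol c ds ↭ c ∷ ds
insertCol-↭ c []       = ↭-refl
insertCol-↭ c (d ∷ ds) with colLt d c
... | true  = ↭-trans (prep d (insertCol-↭ c ds)) (swap d c ↭-refl)
... | false = ↭-refl

sortCols-↭ : ∀ cs → sortCols cs ↭ cs
sortCols-↭ []       = ↭-refl
sortCols-↭ (c ∷ cs) = ↭-trans (insertCol-↭ c (sortCols cs)) (prep c (sortCols-↭ cs))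

insertCol-sorted : ∀ c ds → All (DistinctBottoms c) ds → AllPairs _<ᶜ_ ds → AllPairs _<ᶜ_ (insertCol c ds)
insertCol-sorted c []       _               _            = [] ∷ []
insertCol-sorted c (d ∷ ds) (c≢d ∷ c≢ds) (d<ds ∷ ds↗) with colLt d c in colLt-d-c
... | true  = All-resp-↭ (↭-sym (insertCol-↭ c ds)) (d<c ∷ d<ds) ∷ insertCol-sorted c ds c≢ds ds↗
  where
  d<c : d <ᶜ c
  d<c = colLt⇒<ᶜ d c (subst T (sym colLt-d-c) tt)
... | false = (c<d ∷ All.map (<ᶜ-trans c<d) d<ds) ∷ d<ds ∷ ds↗
  where
  c<d : c <ᶜ d
  c<d = ≯ᶜ⇒<ᶜ c d c≢d (λ d<c → subst T colLt-d-c (<ᶜ⇒colLt d c d<c))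

sortCols-sorted : ∀ cs → AllPairs DistinctBottoms cs → AllPairs _<ᶜ_ (sortCols cs)
sortCols-sorted []       []             = []
sortCols-sorted (c ∷ cs) (c≢cs ∷ cs≢) =
  insertCol-sorted c (sortCols cs) (All-resp-↭ (↭-sym (sortCols-↭ cs)) c≢cs) (sortCols-sorted cs cs≢)

open StrictOrder <ᶜ-irrefl <ᶜ-trans using () renaming
  (strictlyMonotone-reflects to <ᶜ-monotone-reflects; sorted-unique to <ᶜ-sorted-unique)

column : ∀ {m} → (Fin m → ℕ) → Fin m → ℕ × ℕ
column u i = u i , suc (toℕ i)

<ᶜ-transfer : ∀ {m n} {u : Fin m → ℕ} {v : Fin n → ℕ} {f} → PatternEmbedding u v f →
              ∀ a b → column u a <ᶜ column u b ⇔ column v (f a) <ᶜ column v (f b)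
<ᶜ-transfer (f↑ , u≅vf) a b =
  <ᶜ-resp-⇔ (proj₁ (u≅vf a b)) (proj₂ (u≅vf a b)) (proj₁ (positions-sameOrderType f↑ b a))

columns : List ℕ → Biword
columns x = map Product.swap (zip (idW (length x)) x)

columns-tabulate : ∀ {m} (u : Fin m → ℕ) → columns (tabulate u) ≡ tabulate (column u)
columns-tabulate = shifted (λ i → i)
  where
  shifted : ∀ {m} (f : ℕ → ℕ) (u : Fin m → ℕ) →
            map Product.swap (zip (map suc (applyUpTo f (length (tabulate u)))) (tabulate u))
            ≡ tabulate (λ i → u i , suc (f (toℕ i)))
  shifted {zero}  f u = refl
  shifted {suc m} f u = cong ((u Fin.zero , suc (f 0)) ∷_) (shifted (f ∘ suc) (u ∘ Fin.suc))

columns-lookup : ∀ x → columns x ≡ tabulate (column (lookup x))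
columns-lookup x = trans (cong columns (sym (tabulate-lookup x))) (columns-tabulate (lookup x))

columns-distinctBottoms : ∀ {m} (u : Fin m → ℕ) → AllPairs DistinctBottoms (tabulate (column u))
columns-distinctBottoms u = AllPairs.tabulate⁺ (λ i≢j → i≢j ∘ Finₚ.toℕ-injective ∘ suc-injective)

sortedColumns : List ℕ → Biword
sortedColumns x = sortCols (columns x)

sortedColumns-↭ : ∀ x → sortedColumns x ↭ tabulate (column (lookup x))
sortedColumns-↭ x = ↭-trans (sortCols-↭ (columns x)) (↭-reflexive (columns-lookup x))

sortedColumns-sorted : ∀ x → AllPairs _<ᶜ_ (sortedColumns x)
sortedColumns-sorted x =
  sortCols-sorted (columns x) (subst (AllPairs _) (sym (columns-lookup x)) (columns-distinctBottoms (lookup x)))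

column-injective : ∀ {m} {u : Fin m → ℕ} {i j} → column u i ≡ column u j → i ≡ j
column-injective = Finₚ.toℕ-injective ∘ suc-injective ∘ cong proj₂

-- The positions listed by γ

private
  slot : ∀ x → Fin (length (γ x)) → Fin (length (sortedColumns x))
  slot x = cast (length-map proj₂ (sortedColumns x))

γ-position : ∀ x → Fin (length (γ x)) → Fin (length x)
γ-position x p = proj₁ (∈-tabulate⁻ (∈-resp-↭ (sortedColumns-↭ x) (∈-lookup (slot x p))))

lookup-sortedColumns : ∀ x p → lookup (sortedColumns x) (slot x p) ≡ column (lookup x) (γ-position x p)
lookup-sortedColumns x p = proj₂ (∈-tabulate⁻ (∈-resp-↭ (sortedColumns-↭ x) (∈-lookup (slot x p))))

lookup-γ : ∀ x p → lookup (γ x) p ≡ suc (toℕ (γ-position x p))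
lookup-γ x p = trans (lookup-map proj₂ (sortedColumns x) p) (cong proj₂ (lookup-sortedColumns x p))

γ-position-increasing : ∀ x {p q} → p <ꟳ q →
                        column (lookup x) (γ-position x p) <ᶜ column (lookup x) (γ-position x q)
γ-position-increasing x {p} {q} p<q =
  subst₂ _<ᶜ_ (lookup-sortedColumns x p) (lookup-sortedColumns x q)
    (AllPairs-lookup (sortedColumns-sorted x)
      (subst₂ _<_ (sym (Finₚ.toℕ-cast _ p)) (sym (Finₚ.toℕ-cast _ q)) p<q))

column∈sortedColumns : ∀ x i → column (lookup x) i ∈ sortedColumns x
column∈sortedColumns x i = ∈-resp-↭ (↭-sym (sortedColumns-↭ x)) (∈-tabulate⁺ i)

γ-index : ∀ x → Fin (length x) → Fin (length (γ x))
γ-index x i = cast (sym (length-map proj₂ (sortedColumns x))) (index (column∈sortedColumns x i))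

γ-position-index : ∀ x i → γ-position x (γ-index x i) ≡ i
γ-position-index x i = column-injective {u = lookup x} (begin
  column (lookup x) (γ-position x (γ-index x i)) ≡⟨ lookup-sortedColumns x (γ-index x i) ⟨
  lookup (sortedColumns x) (slot x (γ-index x i)) ≡⟨ cong (lookup (sortedColumns x)) cast-cancel ⟩
  lookup (sortedColumns x) (index i∈)             ≡⟨ lookup-index i∈ ⟨
  column (lookup x) i                             ∎)
  where
  open ≡-Reasoning
  i∈ : column (lookup x) i ∈ sortedColumns x
  i∈ = column∈sortedColumns x i
  cast-cancel : slot x (γ-index x i) ≡ index i∈
  cast-cancel = trans (Finₚ.cast-trans (sym (length-map proj₂ (sortedColumns x))) (length-map proj₂ (sortedColumns x)) (index i∈))
    (Finₚ.cast-is-id _ (index i∈))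

<ᶜ⇒γ-index-< : ∀ x {i j} → column (lookup x) i <ᶜ column (lookup x) j → γ-index x i <ꟳ γ-index x j
<ᶜ⇒γ-index-< x {i} {j} ci<cj =
  <ᶜ-monotone-reflects (column (lookup x) ∘ γ-position x) (γ-position-increasing x)
    (subst₂ (λ a b → column (lookup x) a <ᶜ column (lookup x) b)
      (sym (γ-position-index x i)) (sym (γ-position-index x j)) ci<cj)

γ-tabulate : ∀ {m n} (w : Fin n → ℕ) (π : Fin m → Fin n) → (∀ i → ∃ λ c → π c ≡ i) →
             (∀ {c d} → c <ꟳ d → column w (π c) <ᶜ column w (π d)) →
             γ (tabulate w) ≡ tabulate (suc ∘ toℕ ∘ π)
γ-tabulate w π π-onto increasing = begin
  γ (tabulate w)                      ≡⟨ cong (map proj₂) sortedColumns≡ ⟩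
  map proj₂ (tabulate (column w ∘ π)) ≡⟨ map-tabulate (column w ∘ π) proj₂ ⟩
  tabulate (suc ∘ toℕ ∘ π)            ∎
  where
  open ≡-Reasoning
  sorted↭ : sortedColumns (tabulate w) ↭ tabulate (column w)
  sorted↭ = ↭-trans (sortCols-↭ _) (↭-reflexive (columns-tabulate w))
  reindex : ∀ {z} → z ∈ tabulate (column w ∘ π) ⇔ z ∈ tabulate (column w)
  reindex = ∈-tabulate-reindex (column w) π π-onto
  sortedColumns≡ : sortedColumns (tabulate w) ≡ tabulate (column w ∘ π)
  sortedColumns≡ = <ᶜ-sorted-unique (sortedColumns-sorted (tabulate w)) (AllPairs.tabulate⁺-< increasing)
    (from reindex ∘ ∈-resp-↭ sorted↭) (∈-resp-↭ (↭-sym sorted↭) ∘ to reindex)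

γ-preserves-≼ : ∀ {y x} → y ≼ x → γ y ≼ γ x
γ-preserves-≼ {y} {x} (f , f↑ , y≅xf) = g , g↑ , γy≅γxg
  where
  g : Fin (length (γ y)) → Fin (length (γ x))
  g = γ-index x ∘ f ∘ γ-position y
  g↑ : StrictlyIncreasing g
  g↑ p q p<q = <ᶜ⇒γ-index-< x
    (to (<ᶜ-transfer {u = lookup y} {v = lookup x} (f↑ , y≅xf) _ _) (γ-position-increasing y p<q))
  lookup-γ-g : ∀ p → lookup (γ x) (g p) ≡ suc (toℕ (f (γ-position y p)))
  lookup-γ-g p = trans (lookup-γ x (g p)) (cong (suc ∘ toℕ) (γ-position-index x _))
  γy≅γxg : SameOrderType (lookup (γ y)) (lookup (γ x) ∘ g)
  γy≅γxg p q rewrite lookup-γ y p | lookup-γ y q | lookup-γ-g p | lookup-γ-g q =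
    positions-sameOrderType f↑ (γ-position y p) (γ-position y q)

zeroBased : ∀ {v n} → 1 ≤ v → v ≤ n → Fin n
zeroBased {suc v} _ v<n = fromℕ< v<n

suc-zeroBased : ∀ {v n} (1≤v : 1 ≤ v) (v≤n : v ≤ n) → suc (toℕ (zeroBased 1≤v v≤n)) ≡ v
suc-zeroBased {suc v} _ v<n = cong suc (Finₚ.toℕ-fromℕ< v<n)

Perm⇒zeroBased : ∀ {σ} → Perm (length σ) σ →
                 ∃ λ (π : Fin (length σ) → Fin (length σ)) →
                   (∀ c → lookup σ c ≡ suc (toℕ (π c))) × Injective _≡_ _≡_ π
Perm⇒zeroBased {σ} (_ , σ-range , σ-injective) = π , lookup-σ , π-injective
  where
  π : Fin (length σ) → Fin (length σ)
  π c = zeroBased (proj₁ (σ-range c)) (proj₂ (σ-range c))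
  lookup-σ : ∀ c → lookup σ c ≡ suc (toℕ (π c))
  lookup-σ c = sym (suc-zeroBased (proj₁ (σ-range c)) (proj₂ (σ-range c)))
  π-injective : Injective _≡_ _≡_ π
  π-injective {c} {d} πc≡πd =
    σ-injective c d (trans (lookup-σ c) (trans (cong (suc ∘ toℕ) πc≡πd) (sym (lookup-σ d))))

γ-of-standardised-subword :
  ∀ x {m} (π : Fin m → Fin m) (P : Fin m → Fin (length x)) → Injective _≡_ _≡_ π →
  (∀ {c d} → π c <ꟳ π d → P c <ꟳ P d) →
  (∀ {c d} → c <ꟳ d → column (lookup x) (P c) <ᶜ column (lookup x) (P d)) →
  ∃ λ w → IsCayley (tabulate w) × tabulate w ≼ x × γ (tabulate w) ≡ tabulate (suc ∘ toℕ ∘ π)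
γ-of-standardised-subword x π P π-injective π<⇒P< P-increasing =
  w , w-cayley , tabulate-≼ {x = x} embedding , γ-tabulate w π π-onto columns-increasing
  where
  π-onto : ∀ a → ∃ λ c → π c ≡ a
  π-onto = injective⇒surjective π π-injective
  F : Fin _ → Fin (length x)
  F = P ∘ proj₁ ∘ π-onto
  F↑ : StrictlyIncreasing F
  F↑ a b a<b = π<⇒P< (subst₂ _<ꟳ_ (sym (proj₂ (π-onto a))) (sym (proj₂ (π-onto b))) a<b)
  F∘π : ∀ c → F (π c) ≡ P c
  F∘π c = cong P (π-injective (proj₂ (π-onto (π c))))
  standard : ∃ λ w → IsCayley (tabulate w) × SameOrderType w (lookup x ∘ F)
  standard = standardisation (lookup x ∘ F)
  w : Fin _ → ℕ
  w = proj₁ standard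
  w-cayley : IsCayley (tabulate w)
  w-cayley = proj₁ (proj₂ standard)
  embedding : PatternEmbedding w (lookup x) F
  embedding = F↑ , proj₂ (proj₂ standard)
  columns-increasing : ∀ {c d} → c <ꟳ d → column w (π c) <ᶜ column w (π d)
  columns-increasing {c} {d} c<d = from (<ᶜ-transfer {v = lookup x} embedding (π c) (π d))
    (subst₂ (λ i j → column (lookup x) i <ᶜ column (lookup x) j) (sym (F∘π c)) (sym (F∘π d))
      (P-increasing c<d))

γ-≼-lift : ∀ x {k} σ → Perm k σ → σ ≼ γ x → ∃ λ y → Cay k y × y ≼ x × γ y ≡ σ
γ-≼-lift x σ σ-perm@(refl , _) (h , h↑ , σ≅γxh) with Perm⇒zeroBased {σ} σ-perm
... | π , lookup-σ , π-injective =
  let w , w-cayley , w≼x , γw≡π = γ-of-standardised-subword x π P π-injective π<⇒P< P-increasing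
  in  tabulate w , (length-tabulate w , w-cayley) , w≼x , trans γw≡π π≡σ
  where
  P : Fin (length σ) → Fin (length x)
  P = γ-position x ∘ h
  π<⇒P< : ∀ {c d} → π c <ꟳ π d → P c <ꟳ P d
  π<⇒P< {c} {d} πc<πd = s≤s⁻¹ (subst₂ _<_ (lookup-γ x (h c)) (lookup-γ x (h d))
    (to (proj₁ (σ≅γxh c d)) (subst₂ _<_ (sym (lookup-σ c)) (sym (lookup-σ d)) (s≤s πc<πd))))
  P-increasing : ∀ {c d} → c <ꟳ d → column (lookup x) (P c) <ᶜ column (lookup x) (P d)
  P-increasing c<d = γ-position-increasing x (h↑ _ _ c<d)
  π≡σ : tabulate (suc ∘ toℕ ∘ π) ≡ σ
  π≡σ = trans (tabulate-cong (sym ∘ lookup-σ)) (tabulate-lookup σ)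

-- Neither part needs x or y to be a Cayley permutation.
mainTheorem14 : ∀ (n : ℕ) (x : List ℕ) → Cay n x →
    (∀ (k : ℕ) (y : List ℕ) → Cay k y → y ≼ x → γ y ≼ γ x) ×
    (∀ (k : ℕ) (σ : List ℕ) → Perm k σ → σ ≼ γ x →
      ∃ λ (y : List ℕ) → Cay k y × y ≼ x × γ y ≡ σ)
mainTheorem14 n x _ = (λ _ y _ → γ-preserves-≼ {y} {x}) , (λ _ σ σ-perm → γ-≼-lift x σ σ-perm)
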